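{- For every formula $A$ of $\mathbf{EQC}$, $\vdash_{\mathbf{IQC}} A^{\bot}\leftrightarrow A^F$, where $A^\bot$ denotes the Flagg–Friedman translation $A^{(\bot)}_{\{\bot\}}$ with $\Gamma=\{\bot\}$ and $E=\bot$.
   Context: $\mathbf{IQC}$ is intuitionistic first-order predicate calculus with equality, primitives $\vee,\wedge,\supset,\exists,\forall,\bot$, $\neg A:=A\supset\bot$, $\neg^2A:=\neg\neg A$. $\mathbf{EQC}$ is classical first-order predicate calculus with equality plus the S4 modal operator $\Box$. $\neg_E A$ denotes $A\supset E$. Flagg–Friedman translation: for a finite set $\Gamma$ of $\mathbf{IQC}$-formulas and $E\in\Gamma$: $B^{(E)}_\Gamma=\neg_E\neg_E B$ for atomic $B$; $(A\vee B)^{(E)}_\Gamma=\neg_E\neg_E(A^{(E)}_\Gamma\vee B^{(E)}_\Gamma)$; $(A\wedge B)^{(E)}_\Gamma=A^{(E)}_\Gamma\wedge B^{(E)}_\Gamma$; $(A\supset B)^{(E)}_\Gamma=A^{(E)}_\Gamma\supset B^{(E)}_\Gamma$; $(\Box A)^{(E)}_\Gamma=\neg_E\neg_E\bigwedge_{C\in\Gamma}A^{(C)}_\Gamma$; $(\exists xA)^{(E)}_\Gamma=\neg_E\neg_E\exists x A^{(E)}_\Gamma$; $(\forall x A)^{(E)}_\Gamma=\forall x A^{(E)}_\Gamma$. Translation $A^F$: $A^F=\neg^2A$ for atomic $A$; $(A\vee B)^F=\neg^2(A^F\vee B^F)$; $(A\wedge B)^F=A^F\wedge B^F$; $(A\supset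 B)^F=A^F\supset B^F$; $(\Box A)^F=A^F$; $(\exists xA)^F=\neg^2\exists xA^F$; $(\forall xA)^F=\forall xA^F$. -}

module Defs where

open import Data.Nat using (ℕ; zero; suc)
open import Data.Fin using (Fin; zero; suc)
open import Data.Vec using (Vec; []; _∷_)
open import Data.List using (List; []; _∷_; map)

record Signature : Set₁ where
  field
    Fun : ℕ → Set
    Rel : ℕ → Set

module _ (S : Signature) where
  open Signature S

  infixr 6 _∧'_
  infixr 5 _∨'_
  infixr 4 _⊃_
  infix 7 _≐_
  infix 9 _^F _^⊥
  infix 8 ¬_ ¬[_]_
  infix 3 _⇔_

  data Term (n : ℕ) : Set where
    var : Fin n → Term n
    app : ∀ {k} → Fun k → Vec (Term n) k → Term n

  data Formula (n : ℕ) : Set where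
    rel  : ∀ {k} → Rel k → Vec (Term n) k → Formula n
    _≐_  : Term n → Term n → Formula n
    ⊥'   : Formula n
    _∨'_ : Formula n → Formula n → Formula n
    _∧'_ : Formula n → Formula n → Formula n
    _⊃_  : Formula n → Formula n → Formula n
    ∃'   : Formula (suc n) → Formula n
    ∀'   : Formula (suc n) → Formula n

  data EFormula (n : ℕ) : Set where
    rel  : ∀ {k} → Rel k → Vec (Term n) k → EFormula n
    _≐_  : Term n → Term n → EFormula n
    ⊥'   : EFormula n
    _∨'_ : EFormula n → EFormula n → EFormula n
    _∧'_ : EFormula n → EFormula n → EFormula n
    _⊃_  : EFormula n → EFormula n → EFormula n
    ∃'   : EFormula (suc n) → EFormula n
    ∀'   : EFormula (suc n) → EFormula n
    □    : EFormula n → EFormula n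

  mutual
    renT : ∀ {n m} → (Fin n → Fin m) → Term n → Term m
    renT ρ (var i) = var (ρ i)
    renT ρ (app f ts) = app f (renTs ρ ts)

    renTs : ∀ {n m k} → (Fin n → Fin m) → Vec (Term n) k → Vec (Term m) k
    renTs ρ [] = []
    renTs ρ (t ∷ ts) = renT ρ t ∷ renTs ρ ts

  mutual
    subT : ∀ {n m} → (Fin n → Term m) → Term n → Term m
    subT σ (var i) = σ i
    subT σ (app f ts) = app f (subTs σ ts)

    subTs : ∀ {n m k} → (Fin n → Term m) → Vec (Term n) k → Vec (Term m) k
    subTs σ [] = []
    subTs σ (t ∷ ts) = subT σ t ∷ subTs σ ts

  liftR : ∀ {n m} → (Fin n → Fin m) → Fin (suc n) → Fin (suc m)
  liftR ρ zero = zero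
  liftR ρ (suc i) = suc (ρ i)

  liftS : ∀ {n m} → (Fin n → Term m) → Fin (suc n) → Term (suc m)
  liftS σ zero = var zero
  liftS σ (suc i) = renT suc (σ i)

  ren : ∀ {n m} → (Fin n → Fin m) → Formula n → Formula m
  ren ρ (rel r ts) = rel r (renTs ρ ts)
  ren ρ (s ≐ t) = renT ρ s ≐ renT ρ t
  ren ρ ⊥' = ⊥'
  ren ρ (A ∨' B) = ren ρ A ∨' ren ρ B
  ren ρ (A ∧' B) = ren ρ A ∧' ren ρ B
  ren ρ (A ⊃ B) = ren ρ A ⊃ ren ρ B
  ren ρ (∃' A) = ∃' (ren (liftR ρ) A)
  ren ρ (∀' A) = ∀' (ren (liftR ρ) A)

  sub : ∀ {n m} → (Fin n → Term m) → Formula n → Formula m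
  sub σ (rel r ts) = rel r (subTs σ ts)
  sub σ (s ≐ t) = subT σ s ≐ subT σ t
  sub σ ⊥' = ⊥'
  sub σ (A ∨' B) = sub σ A ∨' sub σ B
  sub σ (A ∧' B) = sub σ A ∧' sub σ B
  sub σ (A ⊃ B) = sub σ A ⊃ sub σ B
  sub σ (∃' A) = ∃' (sub (liftS σ) A)
  sub σ (∀' A) = ∀' (sub (liftS σ) A)

  wk : ∀ {n} → Formula n → Formula (suc n)
  wk = ren suc

  single : ∀ {n} → Term n → Fin (suc n) → Term n
  single t zero = t
  single t (suc i) = var i

  _[_] : ∀ {n} → Formula (suc n) → Term n → Formula n
  A [ t ] = sub (single t) A

  ¬_ : ∀ {n} → Formula n → Formula n
  ¬ A = A ⊃ ⊥'

  ¬[_]_ : ∀ {n} → Formula n → Formula n → Formula n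
  ¬[ E ] A = A ⊃ E

  _⇔_ : ∀ {n} → Formula n → Formula n → Formula n
  A ⇔ B = (A ⊃ B) ∧' (B ⊃ A)

  data _∈_ {n} (A : Formula n) : List (Formula n) → Set where
    here  : ∀ {Γ} → A ∈ (A ∷ Γ)
    there : ∀ {B Γ} → A ∈ Γ → A ∈ (B ∷ Γ)

  data _⊢_ {n : ℕ} (Γ : List (Formula n)) : Formula n → Set where
    hyp  : ∀ {A} → A ∈ Γ → Γ ⊢ A
    ⊥E   : ∀ {A} → Γ ⊢ ⊥' → Γ ⊢ A
    ∧I   : ∀ {A B} → Γ ⊢ A → Γ ⊢ B → Γ ⊢ (A ∧' B)
    ∧E₁  : ∀ {A B} → Γ ⊢ (A ∧' B) → Γ ⊢ A
    ∧E₂  : ∀ {A B} → Γ ⊢ (A ∧' B) → Γ ⊢ B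
    ∨I₁  : ∀ {A B} → Γ ⊢ A → Γ ⊢ (A ∨' B)
    ∨I₂  : ∀ {A B} → Γ ⊢ B → Γ ⊢ (A ∨' B)
    ∨E   : ∀ {A B C} → Γ ⊢ (A ∨' B) → (A ∷ Γ) ⊢ C → (B ∷ Γ) ⊢ C → Γ ⊢ C
    ⊃I   : ∀ {A B} → (A ∷ Γ) ⊢ B → Γ ⊢ (A ⊃ B)
    ⊃E   : ∀ {A B} → Γ ⊢ (A ⊃ B) → Γ ⊢ A → Γ ⊢ B
    ∀I   : ∀ {A} → map wk Γ ⊢ A → Γ ⊢ ∀' A
    ∀E   : ∀ {A} → Γ ⊢ ∀' A → (t : Term n) → Γ ⊢ (A [ t ])
    ∃I   : ∀ {A} (t : Term n) → Γ ⊢ (A [ t ]) → Γ ⊢ ∃' A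
    ∃E   : ∀ {A C} → Γ ⊢ ∃' A → (A ∷ map wk Γ) ⊢ wk C → Γ ⊢ C
    ≐I   : ∀ {t} → Γ ⊢ (t ≐ t)
    ≐E   : ∀ {s t} (A : Formula (suc n)) → Γ ⊢ (s ≐ t) → Γ ⊢ (A [ s ]) → Γ ⊢ (A [ t ])

  ⊢IQC_ : ∀ {n} → Formula n → Set
  ⊢IQC A = [] ⊢ A

  -- finite conjunction ⋀ over a (list-presented) finite set of formulas
  ⋀ : ∀ {n} → List (Formula n) → Formula n
  ⋀ [] = ⊥' ⊃ ⊥'
  ⋀ (A ∷ []) = A
  ⋀ (A ∷ B ∷ Γ) = A ∧' ⋀ (B ∷ Γ)

  -- Flagg–Friedman translation A^(E)_Γ.  Under a binder, Γ and E are
  -- weakened (they do not mention the bound variable).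
  FF : ∀ {n} → EFormula n → List (Formula n) → Formula n → Formula n
  FF (rel r ts) Γ E = ¬[ E ] ¬[ E ] rel r ts
  FF (s ≐ t)    Γ E = ¬[ E ] ¬[ E ] (s ≐ t)
  FF ⊥'         Γ E = ¬[ E ] ¬[ E ] ⊥'
  FF (A ∨' B)   Γ E = ¬[ E ] ¬[ E ] (FF A Γ E ∨' FF B Γ E)
  FF (A ∧' B)   Γ E = FF A Γ E ∧' FF B Γ E
  FF (A ⊃ B)    Γ E = FF A Γ E ⊃ FF B Γ E
  FF (□ A)      Γ E = ¬[ E ] ¬[ E ] ⋀ (map (λ C → FF A Γ C) Γ)
  FF (∃' A)     Γ E = ¬[ E ] ¬[ E ] ∃' (FF A (map wk Γ) (wk E))
  FF (∀' A)     Γ E = ∀' (FF A (map wk Γ) (wk E))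

  _^⊥ : ∀ {n} → EFormula n → Formula n
  A ^⊥ = FF A (⊥' ∷ []) ⊥'

  _^F : ∀ {n} → EFormula n → Formula n
  rel r ts ^F = ¬ ¬ rel r ts
  (s ≐ t) ^F  = ¬ ¬ (s ≐ t)
  ⊥' ^F       = ¬ ¬ ⊥'
  (A ∨' B) ^F = ¬ ¬ (A ^F ∨' B ^F)
  (A ∧' B) ^F = A ^F ∧' B ^F
  (A ⊃ B) ^F  = A ^F ⊃ B ^F
  □ A ^F      = A ^F
  ∃' A ^F     = ¬ ¬ ∃' (A ^F)
  ∀' A ^F     = ∀' (A ^F)

{-# OPTIONS --safe #-}
-- A^⊥ and A^F differ only at □: (□ A)^⊥ is ¬¬ A^⊥ while (□ A)^F is A^F.
-- Every A^F is ¬¬-stable (atoms, ∨ and ∃ are double negations, and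
-- stability is preserved by ∧, ⊃ and ∀), so the extra ¬¬ can be dropped,
-- and the two translations are proved interderivable by a simultaneous
-- induction in which ⊃ swaps the directions.
module Submission where

open import Data.Nat using (ℕ; suc)
open import Data.Fin using (Fin; zero; suc)
open import Data.Vec using (Vec; []; _∷_)
open import Relation.Binary.PropositionalEquality using (_≡_; refl; cong; cong₂; subst; sym)
open import Defs

module _ (S : Signature) where

  infix 2 _⟹_

  _⟹_ : ∀ {n} → Formula S n → Formula S n → Set
  X ⟹ Y = ∀ {Γ} → _⊢_ S Γ (X ⊃ Y)

  ¬¬_ : ∀ {n} → Formula S n → Formula S n
  ¬¬ X = ¬_ S (¬_ S X)

  Stable : ∀ {n} → Formula S n → Set
  Stable X = ¬¬ X ⟹ X

  _RightInverseOf_ : ∀ {n m} → (Fin m → Term S n) → (Fin n → Fin m) → Set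
  σ RightInverseOf ρ = ∀ i → σ (ρ i) ≡ var i

  lift-rightInverse : ∀ {n m} {ρ : Fin n → Fin m} {σ : Fin m → Term S n} →
                      σ RightInverseOf ρ → liftS S σ RightInverseOf liftR S ρ
  lift-rightInverse inv zero    = refl
  lift-rightInverse inv (suc i) = cong (renT S suc) (inv i)

  mutual
    subT-renT : ∀ {n m} {ρ : Fin n → Fin m} {σ} → σ RightInverseOf ρ →
                (t : Term S n) → subT S σ (renT S ρ t) ≡ t
    subT-renT inv (var i)    = inv i
    subT-renT inv (app f ts) = cong (app f) (subTs-renTs inv ts)

    subTs-renTs : ∀ {n m k} {ρ : Fin n → Fin m} {σ} → σ RightInverseOf ρ →
                  (ts : Vec (Term S n) k) → subTs S σ (renTs S ρ ts) ≡ ts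
    subTs-renTs inv []       = refl
    subTs-renTs inv (t ∷ ts) = cong₂ _∷_ (subT-renT inv t) (subTs-renTs inv ts)

  sub-ren : ∀ {n m} {ρ : Fin n → Fin m} {σ} → σ RightInverseOf ρ →
            (A : Formula S n) → sub S σ (ren S ρ A) ≡ A
  sub-ren inv (rel r ts) = cong (rel r) (subTs-renTs inv ts)
  sub-ren inv (s ≐ t)    = cong₂ _≐_ (subT-renT inv s) (subT-renT inv t)
  sub-ren inv ⊥'         = refl
  sub-ren inv (A ∨' B)   = cong₂ _∨'_ (sub-ren inv A) (sub-ren inv B)
  sub-ren inv (A ∧' B)   = cong₂ _∧'_ (sub-ren inv A) (sub-ren inv B)
  sub-ren inv (A ⊃ B)    = cong₂ _⊃_ (sub-ren inv A) (sub-ren inv B)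
  sub-ren inv (∃' A)     = cong ∃' (sub-ren (lift-rightInverse inv) A)
  sub-ren inv (∀' A)     = cong ∀' (sub-ren (lift-rightInverse inv) A)

  instantiate-wk-var : ∀ {n} (X : Formula S (suc n)) →
                       _[_] S (ren S (liftR S suc) X) (var zero) ≡ X
  instantiate-wk-var = sub-ren inverse
    where
    inverse : single S (var zero) RightInverseOf liftR S suc
    inverse zero    = refl
    inverse (suc i) = refl

  ∀E-var : ∀ {n Γ} {X : Formula S (suc n)} →
           _⊢_ S Γ (∀' (ren S (liftR S suc) X)) → _⊢_ S Γ X
  ∀E-var {X = X} d = subst (_⊢_ S _) (instantiate-wk-var X) (∀E d (var zero))

  ∃I-var : ∀ {n Γ} {X : Formula S (suc n)} →
           _⊢_ S Γ X → _⊢_ S Γ (∃' (ren S (liftR S suc) X))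
  ∃I-var {X = X} d = ∃I (var zero) (subst (_⊢_ S _) (sym (instantiate-wk-var X)) d)

  ¬¬-intro : ∀ {n} {X : Formula S n} → X ⟹ ¬¬ X
  ¬¬-intro = ⊃I (⊃I (⊃E (hyp here) (hyp (there here))))

  ¬¬-mono : ∀ {n} {X Y : Formula S n} → X ⟹ Y → ¬¬ X ⟹ ¬¬ Y
  ¬¬-mono f = ⊃I (⊃I (⊃E (hyp (there here)) (⊃I (⊃E (hyp (there here)) (⊃E f (hyp here))))))

  ∨-mono : ∀ {n} {X X' Y Y' : Formula S n} → X ⟹ X' → Y ⟹ Y' → X ∨' Y ⟹ X' ∨' Y'
  ∨-mono f g = ⊃I (∨E (hyp here) (∨I₁ (⊃E f (hyp here))) (∨I₂ (⊃E g (hyp here))))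

  ∧-mono : ∀ {n} {X X' Y Y' : Formula S n} → X ⟹ X' → Y ⟹ Y' → X ∧' Y ⟹ X' ∧' Y'
  ∧-mono f g = ⊃I (∧I (⊃E f (∧E₁ (hyp here))) (⊃E g (∧E₂ (hyp here))))

  ⊃-mono : ∀ {n} {X X' Y Y' : Formula S n} → X' ⟹ X → Y ⟹ Y' → (X ⊃ Y) ⟹ (X' ⊃ Y')
  ⊃-mono f g = ⊃I (⊃I (⊃E g (⊃E (hyp (there here)) (⊃E f (hyp here)))))

  ∀-mono : ∀ {n} {X Y : Formula S (suc n)} → X ⟹ Y → ∀' X ⟹ ∀' Y
  ∀-mono f = ⊃I (∀I (⊃E f (∀E-var (hyp here))))

  ∃-mono : ∀ {n} {X Y : Formula S (suc n)} → X ⟹ Y → ∃' X ⟹ ∃' Y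
  ∃-mono f = ⊃I (∃E (hyp here) (∃I-var (⊃E f (hyp here))))

  ¬-stable : ∀ {n} {X : Formula S n} → Stable (¬_ S X)
  ¬-stable = ⊃I (⊃I (⊃E (hyp (there here)) (⊃I (⊃E (hyp here) (hyp (there here))))))

  ∧-stable : ∀ {n} {X Y : Formula S n} → Stable X → Stable Y → Stable (X ∧' Y)
  ∧-stable sX sY = ⊃I (∧I (⊃E sX (⊃E (¬¬-mono (⊃I (∧E₁ (hyp here)))) (hyp here)))
                          (⊃E sY (⊃E (¬¬-mono (⊃I (∧E₂ (hyp here)))) (hyp here))))

  ⊃-stable : ∀ {n} {X Y : Formula S n} → Stable Y → Stable (X ⊃ Y)
  ⊃-stable sY = ⊃I (⊃I (⊃E sY (⊃I (⊃E (hyp (there (there here)))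
                   (⊃I (⊃E (hyp (there here)) (⊃E (hyp here) (hyp (there (there here))))))))))

  ∀-stable : ∀ {n} {X : Formula S (suc n)} → Stable X → Stable (∀' X)
  ∀-stable sX = ⊃I (∀I (⊃E sX (⊃E (¬¬-mono (⊃I (∀E-var (hyp here)))) (hyp here))))

  ^F-stable : ∀ {n} (A : EFormula S n) → Stable (_^F S A)
  ^F-stable (rel r ts) = ¬-stable
  ^F-stable (s ≐ t)    = ¬-stable
  ^F-stable ⊥'         = ¬-stable
  ^F-stable (A ∨' B)   = ¬-stable
  ^F-stable (A ∧' B)   = ∧-stable (^F-stable A) (^F-stable B)
  ^F-stable (A ⊃ B)    = ⊃-stable (^F-stable B)
  ^F-stable (∃' A)     = ¬-stable
  ^F-stable (∀' A)     = ∀-stable (^F-stable A)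
  ^F-stable (□ A)      = ^F-stable A

  -- Γ = {⊥} and E = ⊥ are unchanged by weakening, so under a binder A^⊥ is
  -- again (·)^⊥ of the body and the induction hypothesis applies as is.
  mutual
    ^⊥⟹^F : ∀ {n} (A : EFormula S n) → _^⊥ S A ⟹ _^F S A
    ^⊥⟹^F (rel r ts) = ⊃I (hyp here)
    ^⊥⟹^F (s ≐ t)    = ⊃I (hyp here)
    ^⊥⟹^F ⊥'         = ⊃I (hyp here)
    ^⊥⟹^F (A ∨' B)   = ¬¬-mono (∨-mono (^⊥⟹^F A) (^⊥⟹^F B))
    ^⊥⟹^F (A ∧' B)   = ∧-mono (^⊥⟹^F A) (^⊥⟹^F B)
    ^⊥⟹^F (A ⊃ B)    = ⊃-mono (^F⟹^⊥ A) (^⊥⟹^F B)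
    ^⊥⟹^F (∃' A)     = ¬¬-mono (∃-mono (^⊥⟹^F A))
    ^⊥⟹^F (∀' A)     = ∀-mono (^⊥⟹^F A)
    ^⊥⟹^F (□ A)      = ⊃I (⊃E (^F-stable A) (⊃E (¬¬-mono (^⊥⟹^F A)) (hyp here)))

    ^F⟹^⊥ : ∀ {n} (A : EFormula S n) → _^F S A ⟹ _^⊥ S A
    ^F⟹^⊥ (rel r ts) = ⊃I (hyp here)
    ^F⟹^⊥ (s ≐ t)    = ⊃I (hyp here)
    ^F⟹^⊥ ⊥'         = ⊃I (hyp here)
    ^F⟹^⊥ (A ∨' B)   = ¬¬-mono (∨-mono (^F⟹^⊥ A) (^F⟹^⊥ B))
    ^F⟹^⊥ (A ∧' B)   = ∧-mono (^F⟹^⊥ A) (^F⟹^⊥ B)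
    ^F⟹^⊥ (A ⊃ B)    = ⊃-mono (^⊥⟹^F A) (^F⟹^⊥ B)
    ^F⟹^⊥ (∃' A)     = ¬¬-mono (∃-mono (^F⟹^⊥ A))
    ^F⟹^⊥ (∀' A)     = ∀-mono (^F⟹^⊥ A)
    ^F⟹^⊥ (□ A)      = ⊃I (⊃E ¬¬-intro (⊃E (^F⟹^⊥ A) (hyp here)))

proposition4p1 : (S : Signature) {n : ℕ} (A : EFormula S n) →
    ⊢IQC_ S (_⇔_ S (_^⊥ S A) (_^F S A))
proposition4p1 S A = ∧I (^⊥⟹^F S A) (^F⟹^⊥ S A)
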